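{- Let $t\ge 2$ and $\lambda\ge 1$ be integers and let $D$ be a $(t,\lambda)$-liking digraph. If $d^+(v)=t+\lambda-1$ for every vertex $v$ of $D$, then $D$ is isomorphic to the complete digraph $\overleftrightarrow{K}_{t+\lambda}$ on $t+\lambda$ vertices.
   Context: All digraphs are finite and have no loops and no multiple arcs. A digraph $D$ is a $(t,\lambda)$-liking digraph if every set of $t$ distinct vertices of $D$ has exactly $\lambda$ common out-neighbors (the definition presumes $D$ has at least $t$ vertices). $d^+(v)$ is the out-degree of $v$. $\overleftrightarrow{K}_n$ is the digraph on $n$ vertices with both arcs between every pair of distinct vertices. -}

module Defs where

open import Data.Nat using (ℕ; _≤_)
open import Data.Bool using (Bool; true; false; T)
open import Data.Fin using (Fin)
open import Data.Fin.Subset using (Subset; _∈_; ∣_∣)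
open import Data.Product using (Σ; _×_)
open import Data.Empty using (⊥)
open import Relation.Binary.PropositionalEquality using (_≡_; _≢_)
open import Relation.Nullary using (¬_)
open import Function.Bundles using (_⤖_; Bijection)

record Digraph (n : ℕ) : Set where
  field
    arc     : Fin n → Fin n → Bool
    no-loop : ∀ v → arc v v ≡ false
open Digraph public

count : ∀ {n} → (Fin n → Bool) → ℕ
count p = ∣ tabulate p ∣
  where open import Data.Vec using (tabulate)

outdeg : ∀ {n} → Digraph n → Fin n → ℕ
outdeg D v = count (arc D v)

commonOut : ∀ {n} → Digraph n → Subset n → Fin n → Bool
commonOut {n} D S w = allFin (λ u → not (lookup S u) ∨ arc D u w)
  where
  open import Data.Bool using (_∨_; _∧_; not)
  open import Data.Vec using (tabulate; foldr; lookup)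
  allFin : (Fin n → Bool) → Bool
  allFin q = foldr _ _∧_ true (tabulate q)

numCommonOut : ∀ {n} → Digraph n → Subset n → ℕ
numCommonOut D S = count (commonOut D S)

IsLiking : ∀ {n} → ℕ → ℕ → Digraph n → Set
IsLiking {n} t λ' D = (t ≤ n) × (∀ (S : Subset n) → ∣ S ∣ ≡ t → numCommonOut D S ≡ λ')

complete : (m : ℕ) → Digraph m
complete m = record { arc = λ u v → ⌊ ¬? (u ≟ v) ⌋ ; no-loop = λ v → lem v }
  where
  open import Data.Fin using (_≟_)
  open import Relation.Nullary using (¬?; yes; no)
  open import Relation.Nullary.Decidable using (⌊_⌋)
  open import Relation.Binary.PropositionalEquality using (refl)
  lem : ∀ v → ⌊ ¬? (v ≟ v) ⌋ ≡ false
  lem v with v ≟ v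
  ... | yes _ = refl
  ... | no v≢v with v≢v refl
  ... | ()

_≅_ : ∀ {n m} → Digraph n → Digraph m → Set
_≅_ {n} {m} D E = Σ (Fin n ⤖ Fin m) λ f →
  ∀ u v → arc E (Bijection.to f u) (Bijection.to f v) ≡ arc D u v

{-# OPTIONS --safe #-}

-- Let k = t + λ − 1 be the common out-degree.  If u → x and u → y with x ≠ y, add t − 2
-- out-neighbours B of u other than x, y; the t-set {u, x} ∪ B can only be liked by the λ
-- vertices of N⁺(u) ∖ ({x} ∪ B), so it is liked by all of them, y included: x → y.  Hence
-- every out-neighbourhood spans a complete digraph.  Arcs are symmetric: if u → x but not
-- x → u, counting gives an out-neighbour c of x outside N⁺(u) ∪ {u}, and the clique property
-- yields N⁺(u) ⊆ N⁺(c); then {u, c} ∪ B with B ⊆ N⁺(u) of size t − 2 is liked by the λ + 1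
-- vertices of N⁺(u) ∖ B, too many.  Finally a vertex v ≠ u with u ↛ v would share an
-- out-neighbour w with u (λ ≥ 1), and the clique property at w gives u → v.  So D is
-- complete and has k + 1 = t + λ vertices.
module Submission where

open import Defs
open import Data.Bool using (Bool; true; false; _∧_; _∨_; not)
open import Data.Bool.Properties using (∧-conicalˡ; ∧-conicalʳ)
open import Data.Empty using (⊥-elim)
open import Data.Fin using (Fin; zero; suc; fromℕ<; _≟_)
open import Data.Fin.Subset
  using (Subset; inside; outside; _∈_; _∉_; _⊆_; _⊈_; ∣_∣; ⁅_⁆; _∪_; _─_; _-_; ⊥; ⊤; Nonempty)
open import Data.Fin.Subset.Properties
open import Data.Nat using (ℕ; zero; suc; _+_; _∸_; _≤_; _<_; _≥_; z≤n; s≤s)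
open import Data.Nat.Properties
  using (≤-reflexive; ≤-trans; ≤⇒≯; <⇒≤; 1+n≰n; m≤m+n; n≤1+n; +-suc; +-cancelˡ-≡; suc-injective;
         module ≤-Reasoning)
open import Data.Product using (∃; _×_; _,_)
open import Data.Sum using (_⊎_; inj₁; inj₂; [_,_])
import Data.Sum as Sum
open import Data.Vec using ([]; _∷_; here; there; tabulate; lookup; foldr)
open import Data.Vec.Properties using (lookup∘tabulate; []=⇒lookup; lookup⇒[]=)
open import Function using (_∘_)
open import Function.Construct.Identity using (⤖-id)
open import Relation.Binary.PropositionalEquality
  using (_≡_; _≢_; refl; sym; trans; cong; cong₂; subst; module ≡-Reasoning)
open import Relation.Nullary using (yes; no; contradiction)

private
  variable
    n : ℕ
    x y : Fin n
    p q : Subset n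

x∈p─q⇒x∉q : ∀ (p q : Subset n) → x ∈ p ─ q → x ∉ q
x∈p─q⇒x∉q (_ ∷ p) (_ ∷ q) (there x∈p─q) (there x∈q) = x∈p─q⇒x∉q p q x∈p─q x∈q
x∈p─q⇒x∉q (_ ∷ _) (inside ∷ _) () here

x∈⁅y⁆∪p⁻ : x ∈ ⁅ y ⁆ ∪ p → x ≡ y ⊎ x ∈ p
x∈⁅y⁆∪p⁻ {y = y} {p = p} = Sum.map₁ (x∈⁅y⁆⇒x≡y y) ∘ x∈p∪q⁻ ⁅ y ⁆ p

x∈⁅x⁆∪p : x ∈ ⁅ x ⁆ ∪ p
x∈⁅x⁆∪p {x = x} = x∈p∪q⁺ (inj₁ (x∈⁅x⁆ x))

⁅x⁆∪p⊆q : x ∈ q → p ⊆ q → ⁅ x ⁆ ∪ p ⊆ q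
⁅x⁆∪p⊆q {q = q} x∈q p⊆q y∈ = [ (λ y≡x → subst (_∈ q) (sym y≡x) x∈q) , p⊆q ] (x∈⁅y⁆∪p⁻ y∈)

∣p∪q∣≡∣p∣+∣q∣ : ∀ (p q : Subset n) → (∀ {x} → x ∈ p → x ∉ q) → ∣ p ∪ q ∣ ≡ ∣ p ∣ + ∣ q ∣
∣p∪q∣≡∣p∣+∣q∣ [] [] _ = refl
∣p∪q∣≡∣p∣+∣q∣ (inside ∷ p) (inside ∷ q) disjoint = ⊥-elim (disjoint here here)
∣p∪q∣≡∣p∣+∣q∣ (inside ∷ p) (outside ∷ q) disjoint =
  cong suc (∣p∪q∣≡∣p∣+∣q∣ p q (λ x∈p x∈q → disjoint (there x∈p) (there x∈q)))
∣p∪q∣≡∣p∣+∣q∣ (outside ∷ p) (inside ∷ q) disjoint =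
  trans (cong suc (∣p∪q∣≡∣p∣+∣q∣ p q (λ x∈p x∈q → disjoint (there x∈p) (there x∈q))))
        (sym (+-suc ∣ p ∣ ∣ q ∣))
∣p∪q∣≡∣p∣+∣q∣ (outside ∷ p) (outside ∷ q) disjoint =
  ∣p∪q∣≡∣p∣+∣q∣ p q (λ x∈p x∈q → disjoint (there x∈p) (there x∈q))

∣p∣≡∣q∣+∣p─q∣ : ∀ (p q : Subset n) → q ⊆ p → ∣ p ∣ ≡ ∣ q ∣ + ∣ p ─ q ∣
∣p∣≡∣q∣+∣p─q∣ [] [] _ = refl
∣p∣≡∣q∣+∣p─q∣ (inside ∷ p) (inside ∷ q) q⊆p = cong suc (∣p∣≡∣q∣+∣p─q∣ p q (drop-∷-⊆ q⊆p))
∣p∣≡∣q∣+∣p─q∣ (inside ∷ p) (outside ∷ q) q⊆p =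
  trans (cong suc (∣p∣≡∣q∣+∣p─q∣ p q (drop-∷-⊆ q⊆p))) (sym (+-suc ∣ q ∣ ∣ p ─ q ∣))
∣p∣≡∣q∣+∣p─q∣ (outside ∷ p) (inside ∷ q) q⊆p with () ← q⊆p here
∣p∣≡∣q∣+∣p─q∣ (outside ∷ p) (outside ∷ q) q⊆p = ∣p∣≡∣q∣+∣p─q∣ p q (drop-∷-⊆ q⊆p)

∣⁅x⁆∪p∣≡1+∣p∣ : x ∉ p → ∣ ⁅ x ⁆ ∪ p ∣ ≡ suc ∣ p ∣
∣⁅x⁆∪p∣≡1+∣p∣ {x = x} {p = p} x∉p =
  trans (∣p∪q∣≡∣p∣+∣q∣ ⁅ x ⁆ p (λ y∈⁅x⁆ → subst (_∉ p) (sym (x∈⁅y⁆⇒x≡y x y∈⁅x⁆)) x∉p))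
        (cong (_+ ∣ p ∣) (∣⁅x⁆∣≡1 x))

x∈p⇒∣p∣≡1+∣p-x∣ : x ∈ p → ∣ p ∣ ≡ suc ∣ p - x ∣
x∈p⇒∣p∣≡1+∣p-x∣ {x = x} {p = p} x∈p =
  trans (∣p∣≡∣q∣+∣p─q∣ p ⁅ x ⁆ (λ y∈⁅x⁆ → subst (_∈ p) (sym (x∈⁅y⁆⇒x≡y x y∈⁅x⁆)) x∈p))
        (cong (_+ ∣ p - x ∣) (∣⁅x⁆∣≡1 x))

∃x∈q∖p-there : ∀ {a b} → (∃ λ x → x ∈ q × x ∉ p) → ∃ λ x → x ∈ b ∷ q × x ∉ a ∷ p
∃x∈q∖p-there (x , x∈q , x∉p) = suc x , there x∈q , x∉p ∘ drop-there

∣p∣<∣q∣⇒∃x∈q∖p : ∀ (p q : Subset n) → ∣ p ∣ < ∣ q ∣ → ∃ λ x → x ∈ q × x ∉ p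
∣p∣<∣q∣⇒∃x∈q∖p (outside ∷ p) (inside ∷ q) _ = zero , here , λ ()
∣p∣<∣q∣⇒∃x∈q∖p (inside ∷ p) (inside ∷ q) (s≤s ∣p∣<∣q∣) =
  ∃x∈q∖p-there (∣p∣<∣q∣⇒∃x∈q∖p p q ∣p∣<∣q∣)
∣p∣<∣q∣⇒∃x∈q∖p (inside ∷ p) (outside ∷ q) 1+∣p∣<∣q∣ =
  ∃x∈q∖p-there (∣p∣<∣q∣⇒∃x∈q∖p p q (<⇒≤ 1+∣p∣<∣q∣))
∣p∣<∣q∣⇒∃x∈q∖p (outside ∷ p) (outside ∷ q) ∣p∣<∣q∣ =
  ∃x∈q∖p-there (∣p∣<∣q∣⇒∃x∈q∖p p q ∣p∣<∣q∣)

0<∣p∣⇒Nonempty : 0 < ∣ p ∣ → Nonempty p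
0<∣p∣⇒Nonempty {n} {p} 0<∣p∣
  with x , x∈p , _ ← ∣p∣<∣q∣⇒∃x∈q∖p ⊥ p (subst (_< ∣ p ∣) (sym (∣⊥∣≡0 n)) 0<∣p∣) = x , x∈p

p⊆q∧∣q∣≤∣p∣⇒q⊆p : p ⊆ q → ∣ q ∣ ≤ ∣ p ∣ → q ⊆ p
p⊆q∧∣q∣≤∣p∣⇒q⊆p {p = p} p⊆q ∣q∣≤∣p∣ {x} x∈q with x ∈? p
... | yes x∈p = x∈p
... | no x∉p = contradiction (p⊂q⇒∣p∣<∣q∣ (p⊆q , x , x∈q , x∉p)) (≤⇒≯ ∣q∣≤∣p∣)

⊆-withSize : ∀ m (p : Subset n) → m ≤ ∣ p ∣ → ∃ λ q → q ⊆ p × ∣ q ∣ ≡ m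
⊆-withSize _ [] z≤n = [] , ⊆-refl , refl
⊆-withSize m (outside ∷ p) m≤∣p∣ with q , q⊆p , ∣q∣≡m ← ⊆-withSize m p m≤∣p∣ =
  outside ∷ q , out⊆ q⊆p , ∣q∣≡m
⊆-withSize {n} zero (inside ∷ p) _ = ⊥ , ⊥⊆ , ∣⊥∣≡0 (suc n)
⊆-withSize (suc m) (inside ∷ p) (s≤s m≤∣p∣) with q , q⊆p , ∣q∣≡m ← ⊆-withSize m p m≤∣p∣ =
  inside ∷ q , in⊆in q⊆p , cong suc ∣q∣≡m

∧-tabulate⁻ : ∀ (f : Fin n → Bool) →
  foldr (λ _ → Bool) _∧_ true (tabulate f) ≡ true → ∀ i → f i ≡ true
∧-tabulate⁻ f all≡true zero = ∧-conicalˡ _ _ all≡true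
∧-tabulate⁻ f all≡true (suc i) = ∧-tabulate⁻ (f ∘ suc) (∧-conicalʳ _ _ all≡true) i

∧-tabulate⁺ : ∀ (f : Fin n → Bool) →
  (∀ i → f i ≡ true) → foldr (λ _ → Bool) _∧_ true (tabulate f) ≡ true
∧-tabulate⁺ {zero} f _ = refl
∧-tabulate⁺ {suc n} f f≡true = cong₂ _∧_ (f≡true zero) (∧-tabulate⁺ (f ∘ suc) (f≡true ∘ suc))

∈-tabulate⁺ : ∀ {f : Fin n → Bool} → f x ≡ true → x ∈ tabulate f
∈-tabulate⁺ {x = x} {f} fx≡true = lookup⇒[]= x (tabulate f) (trans (lookup∘tabulate f x) fx≡true)

∈-tabulate⁻ : ∀ {f : Fin n → Bool} → x ∈ tabulate f → f x ≡ true
∈-tabulate⁻ {x = x} {f} x∈ = trans (sym (lookup∘tabulate f x)) ([]=⇒lookup x∈)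

module _ (D : Digraph n) where

  outSet : Fin n → Subset n
  outSet u = tabulate (arc D u)

  commonOutSet : Subset n → Subset n
  commonOutSet S = tabulate (commonOut D S)

  ∉outSet : ∀ u → u ∉ outSet u
  ∉outSet u u∈ = contradiction (trans (sym (∈-tabulate⁻ u∈)) (no-loop D u)) λ ()

  ∈outSet⇒≢ : ∀ {u v} → v ∈ outSet u → v ≢ u
  ∈outSet⇒≢ {u} v∈ refl = ∉outSet u v∈

  ∈-commonOutSet⁻ : ∀ {S w v} → w ∈ commonOutSet S → v ∈ S → w ∈ outSet v
  ∈-commonOutSet⁻ {S} {w} {v} w∈ v∈S = ∈-tabulate⁺
    (subst (λ b → not b ∨ arc D v w ≡ true) ([]=⇒lookup v∈S) (∧-tabulate⁻ _ (∈-tabulate⁻ w∈) v))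

  ∈-commonOutSet⁺ : ∀ {S w} → (∀ {v} → v ∈ S → w ∈ outSet v) → w ∈ commonOutSet S
  ∈-commonOutSet⁺ {S} {w} all-out = ∈-tabulate⁺ (∧-tabulate⁺ _ arc-from)
    where
    arc-from : ∀ v → not (lookup S v) ∨ arc D v w ≡ true
    arc-from v with lookup S v in v∈S
    ... | true = ∈-tabulate⁻ (all-out (lookup⇒[]= v S v∈S))
    ... | false = refl

  ∈commonOutSet⇒∉ : ∀ {S w} → w ∈ commonOutSet S → w ∉ S
  ∈commonOutSet⇒∉ {w = w} w∈ w∈S = ∉outSet w (∈-commonOutSet⁻ w∈ w∈S)

  -- t = 2 + s and λ = 1 + l, so the out-degree t + λ − 1 is (1 + s) + (1 + l).
  module Liking (s l : ℕ)
    (liking : ∀ S → ∣ S ∣ ≡ suc (suc s) → numCommonOut D S ≡ suc l)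
    (regular : ∀ v → outdeg D v ≡ suc s + suc l) where

    liking-⁅u⁆∪ : ∀ {u T} → u ∉ T → ∣ T ∣ ≡ suc s → ∣ commonOutSet (⁅ u ⁆ ∪ T) ∣ ≡ suc l
    liking-⁅u⁆∪ {u} {T} u∉T ∣T∣≡1+s =
      liking (⁅ u ⁆ ∪ T) (trans (∣⁅x⁆∪p∣≡1+∣p∣ u∉T) (cong suc ∣T∣≡1+s))

    outSet─⊆commonOutSet : ∀ {u T} → T ⊆ outSet u → ∣ T ∣ ≡ suc s →
      outSet u ─ T ⊆ commonOutSet (⁅ u ⁆ ∪ T)
    outSet─⊆commonOutSet {u} {T} T⊆out ∣T∣≡1+s =
      p⊆q∧∣q∣≤∣p∣⇒q⊆p common⊆out─T
        (≤-reflexive (trans ∣out─T∣≡1+l (sym (liking-⁅u⁆∪ (∉outSet u ∘ T⊆out) ∣T∣≡1+s))))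
      where
      common⊆out─T : commonOutSet (⁅ u ⁆ ∪ T) ⊆ outSet u ─ T
      common⊆out─T w∈ =
        x∈p∧x∉q⇒x∈p─q (∈-commonOutSet⁻ w∈ x∈⁅x⁆∪p) (∈commonOutSet⇒∉ w∈ ∘ q⊆p∪q ⁅ u ⁆ T)
      ∣out─T∣≡1+l : ∣ outSet u ─ T ∣ ≡ suc l
      ∣out─T∣≡1+l = +-cancelˡ-≡ (suc s) _ _ (begin
        suc s + ∣ outSet u ─ T ∣  ≡⟨ cong (_+ ∣ outSet u ─ T ∣) ∣T∣≡1+s ⟨
        ∣ T ∣ + ∣ outSet u ─ T ∣  ≡⟨ ∣p∣≡∣q∣+∣p─q∣ (outSet u) T T⊆out ⟨
        ∣ outSet u ∣              ≡⟨ regular u ⟩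
        suc s + suc l             ∎)
        where open ≡-Reasoning

    s≤∣outSet-x-y∣ : ∀ {u x y} → x ∈ outSet u → y ∈ outSet u → x ≢ y → s ≤ ∣ outSet u - x - y ∣
    s≤∣outSet-x-y∣ {u} {x} {y} x∈ y∈ x≢y = subst (s ≤_) s+l≡∣out-x-y∣ (m≤m+n s l)
      where
      open ≡-Reasoning
      y∈out-x : y ∈ outSet u - x
      y∈out-x = x∈p∧x≢y⇒x∈p-y y∈ (x≢y ∘ sym)
      s+l≡∣out-x-y∣ : s + l ≡ ∣ outSet u - x - y ∣
      s+l≡∣out-x-y∣ = suc-injective (suc-injective (begin
        suc (suc (s + l))               ≡⟨ cong suc (+-suc s l) ⟨
        suc s + suc l                   ≡⟨ regular u ⟨
        ∣ outSet u ∣                    ≡⟨ x∈p⇒∣p∣≡1+∣p-x∣ x∈ ⟩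
        suc ∣ outSet u - x ∣            ≡⟨ cong suc (x∈p⇒∣p∣≡1+∣p-x∣ y∈out-x) ⟩
        suc (suc ∣ outSet u - x - y ∣)  ∎))

    ∃-⊆outSet-containing-avoiding : ∀ {u x y} → x ∈ outSet u → y ∈ outSet u → x ≢ y →
      ∃ λ T → x ∈ T × y ∉ T × T ⊆ outSet u × ∣ T ∣ ≡ suc s
    ∃-⊆outSet-containing-avoiding {u} {x} {y} x∈ y∈ x≢y
      with B , B⊆ , ∣B∣≡s ← ⊆-withSize s (outSet u - x - y) (s≤∣outSet-x-y∣ x∈ y∈ x≢y) =
      ⁅ x ⁆ ∪ B , x∈⁅x⁆∪p , y∉⁅x⁆∪B , ⁅x⁆∪p⊆q x∈ (p─q⊆p _ _ ∘ p─q⊆p _ _ ∘ B⊆) ,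
      trans (∣⁅x⁆∪p∣≡1+∣p∣ x∉B) (cong suc ∣B∣≡s)
      where
      x∉B : x ∉ B
      x∉B x∈B = x∈p─q⇒x∉q (outSet u) ⁅ x ⁆ (p─q⊆p _ _ (B⊆ x∈B)) (x∈⁅x⁆ x)
      y∉B : y ∉ B
      y∉B y∈B = x∈p─q⇒x∉q (outSet u - x) ⁅ y ⁆ (B⊆ y∈B) (x∈⁅x⁆ y)
      y∉⁅x⁆∪B : y ∉ ⁅ x ⁆ ∪ B
      y∉⁅x⁆∪B = [ x≢y ∘ sym , y∉B ] ∘ x∈⁅y⁆∪p⁻

    clique : ∀ {u x y} → x ∈ outSet u → y ∈ outSet u → x ≢ y → y ∈ outSet x
    clique {u} x∈ y∈ x≢y
      with T , x∈T , y∉T , T⊆out , ∣T∣≡1+s ← ∃-⊆outSet-containing-avoiding x∈ y∈ x≢y =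
      ∈-commonOutSet⁻ (outSet─⊆commonOutSet T⊆out ∣T∣≡1+s (x∈p∧x∉q⇒x∈p─q y∈ y∉T))
                      (q⊆p∪q ⁅ u ⁆ T x∈T)

    s≤∣outSet∣ : ∀ u → s ≤ ∣ outSet u ∣
    s≤∣outSet∣ u = subst (s ≤_) (sym (regular u)) (≤-trans (n≤1+n s) (m≤m+n (suc s) (suc l)))

    ∃-tSet-with-nonNeighbour : ∀ {u c} → c ≢ u → c ∉ outSet u →
      ∃ λ B → B ⊆ outSet u × ∣ B ∣ ≡ s × ∣ commonOutSet (⁅ u ⁆ ∪ ⁅ c ⁆ ∪ B) ∣ ≡ suc l
    ∃-tSet-with-nonNeighbour {u} {c} c≢u c∉
      with B , B⊆ , ∣B∣≡s ← ⊆-withSize s (outSet u) (s≤∣outSet∣ u) =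
      B , B⊆ , ∣B∣≡s , liking-⁅u⁆∪ u∉⁅c⁆∪B (trans (∣⁅x⁆∪p∣≡1+∣p∣ (c∉ ∘ B⊆)) (cong suc ∣B∣≡s))
      where
      u∉⁅c⁆∪B : u ∉ ⁅ c ⁆ ∪ B
      u∉⁅c⁆∪B = [ c≢u ∘ sym , ∉outSet u ∘ B⊆ ] ∘ x∈⁅y⁆∪p⁻

    outSet⊈outSet : ∀ {u c} → c ≢ u → c ∉ outSet u → outSet u ⊈ outSet c
    outSet⊈outSet {u} {c} c≢u c∉ out⊆
      with B , B⊆ , ∣B∣≡s , ∣common∣≡1+l ← ∃-tSet-with-nonNeighbour c≢u c∉ =
      1+n≰n (begin
        suc (suc l)                        ≡⟨ ∣out─B∣≡2+l ⟨
        ∣ outSet u ─ B ∣                    ≤⟨ p⊆q⇒∣p∣≤∣q∣ out─B⊆common ⟩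
        ∣ commonOutSet (⁅ u ⁆ ∪ ⁅ c ⁆ ∪ B) ∣  ≡⟨ ∣common∣≡1+l ⟩
        suc l                              ∎)
      where
      open ≤-Reasoning
      ∣out─B∣≡2+l : ∣ outSet u ─ B ∣ ≡ suc (suc l)
      ∣out─B∣≡2+l = +-cancelˡ-≡ s _ _ (begin-equality
        s + ∣ outSet u ─ B ∣      ≡⟨ cong (_+ ∣ outSet u ─ B ∣) ∣B∣≡s ⟨
        ∣ B ∣ + ∣ outSet u ─ B ∣  ≡⟨ ∣p∣≡∣q∣+∣p─q∣ (outSet u) B B⊆ ⟨
        ∣ outSet u ∣              ≡⟨ regular u ⟩
        suc s + suc l             ≡⟨ +-suc s (suc l) ⟨
        s + suc (suc l)           ∎)
      out─B⊆common : outSet u ─ B ⊆ commonOutSet (⁅ u ⁆ ∪ ⁅ c ⁆ ∪ B)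
      out─B⊆common {w} w∈out─B = ∈-commonOutSet⁺ arc-to-w
        where
        w∈out : w ∈ outSet u
        w∈out = p─q⊆p _ _ w∈out─B
        w∉B : w ∉ B
        w∉B = x∈p─q⇒x∉q _ _ w∈out─B
        arc-to-w : ∀ {v} → v ∈ ⁅ u ⁆ ∪ ⁅ c ⁆ ∪ B → w ∈ outSet v
        arc-to-w v∈ with x∈⁅y⁆∪p⁻ v∈
        ... | inj₁ refl = w∈out
        ... | inj₂ v∈⁅c⁆∪B with x∈⁅y⁆∪p⁻ v∈⁅c⁆∪B
        ...   | inj₁ refl = out⊆ w∈out
        ...   | inj₂ v∈B = clique (B⊆ v∈B) w∈out (λ { refl → w∉B v∈B })

    ∃-other-outNeighbour : ∀ {u x} → x ∈ outSet u → ∃ λ x′ → x′ ∈ outSet u × x′ ≢ x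
    ∃-other-outNeighbour {u} {x} x∈ = other (0<∣p∣⇒Nonempty 0<∣out-x∣)
      where
      other : Nonempty (outSet u - x) → ∃ λ x′ → x′ ∈ outSet u × x′ ≢ x
      other (x′ , x′∈) = x′ , p─q⊆p _ _ x′∈ , x∉⁅y⁆⇒x≢y (x∈p─q⇒x∉q _ _ x′∈)
      0<∣out-x∣ : 0 < ∣ outSet u - x ∣
      0<∣out-x∣ = subst (0 <_) (suc-injective (trans (sym (regular u)) (x∈p⇒∣p∣≡1+∣p-x∣ x∈)))
                    (subst (0 <_) (sym (+-suc s l)) (s≤s z≤n))

    outSet⊆outSet-twoStep : ∀ {u x c} → x ∈ outSet u → c ∈ outSet x → c ∉ outSet u →
      outSet u ⊆ outSet c
    outSet⊆outSet-twoStep {u} {x} {c} x∈ c∈ c∉ {w} w∈ with w ≟ x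
    ... | no w≢x = clique c∈ (clique x∈ w∈ (w≢x ∘ sym)) (λ { refl → c∉ w∈ })
    ... | yes refl with x′ , x′∈ , x′≢x ← ∃-other-outNeighbour x∈ =
      clique (clique (clique x∈ x′∈ (x′≢x ∘ sym)) c∈ (λ { refl → c∉ x′∈ }))
             (clique x′∈ x∈ x′≢x) (∈outSet⇒≢ c∈)

    ∣outSet-x∣<∣outSet∣ : ∀ {u x y} → x ∈ outSet u → ∣ outSet u - x ∣ < ∣ outSet y ∣
    ∣outSet-x∣<∣outSet∣ {u} {x} {y} x∈ =
      ≤-reflexive (trans (sym (x∈p⇒∣p∣≡1+∣p-x∣ x∈)) (trans (regular u) (sym (regular y))))

    symmetric : ∀ {u x} → x ∈ outSet u → u ∈ outSet x
    symmetric {u} {x} x∈ with u ∈? outSet x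
    ... | yes u∈ = u∈
    ... | no u∉
      with c , c∈ , c∉out-x ← ∣p∣<∣q∣⇒∃x∈q∖p (outSet u - x) (outSet x) (∣outSet-x∣<∣outSet∣ x∈) =
      ⊥-elim (outSet⊈outSet (λ { refl → u∉ c∈ }) c∉ (outSet⊆outSet-twoStep x∈ c∈ c∉))
      where
      c∉ : c ∉ outSet u
      c∉ c∈out = c∉out-x (x∈p∧x≢y⇒x∈p-y c∈out (∈outSet⇒≢ c∈))

    ∃-common-outNeighbour : ∀ {u v} → v ≢ u → v ∉ outSet u →
      ∃ λ w → w ∈ outSet u × w ∈ outSet v
    ∃-common-outNeighbour {u} {v} v≢u v∉
      with B , _ , _ , ∣common∣≡1+l ← ∃-tSet-with-nonNeighbour v≢u v∉ =
      common (0<∣p∣⇒Nonempty (subst (0 <_) (sym ∣common∣≡1+l) (s≤s z≤n)))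
      where
      common : Nonempty (commonOutSet (⁅ u ⁆ ∪ ⁅ v ⁆ ∪ B)) → ∃ λ w → w ∈ outSet u × w ∈ outSet v
      common (w , w∈) =
        w , ∈-commonOutSet⁻ w∈ x∈⁅x⁆∪p , ∈-commonOutSet⁻ w∈ (q⊆p∪q ⁅ u ⁆ (⁅ v ⁆ ∪ B) x∈⁅x⁆∪p)

    ≢⇒∈outSet : ∀ {u v} → v ≢ u → v ∈ outSet u
    ≢⇒∈outSet {u} {v} v≢u with v ∈? outSet u
    ... | yes v∈ = v∈
    ... | no v∉ with w , w∈u , w∈v ← ∃-common-outNeighbour v≢u v∉ =
      clique (symmetric w∈u) (symmetric w∈v) (v≢u ∘ sym)

    order : Fin n → n ≡ suc (suc s) + suc l
    order u = begin
      n                        ≡⟨ ∣⊤∣≡n n ⟨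
      ∣ ⊤ {n} ∣                ≡⟨ cong ∣_∣ (⊆-antisym ⊤⊆⁅u⁆∪out ⊆⊤) ⟩
      ∣ ⁅ u ⁆ ∪ outSet u ∣     ≡⟨ ∣⁅x⁆∪p∣≡1+∣p∣ (∉outSet u) ⟩
      suc ∣ outSet u ∣         ≡⟨ cong suc (regular u) ⟩
      suc (suc s + suc l)      ∎
      where
      open ≡-Reasoning
      ⊤⊆⁅u⁆∪out : ⊤ ⊆ ⁅ u ⁆ ∪ outSet u
      ⊤⊆⁅u⁆∪out {v} _ with v ≟ u
      ... | yes refl = x∈⁅x⁆∪p
      ... | no v≢u = q⊆p∪q ⁅ u ⁆ (outSet u) (≢⇒∈outSet v≢u)

≅-complete : ∀ {m} (D : Digraph n) → n ≡ m → (∀ {u v} → v ≢ u → v ∈ outSet D u) →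
  D ≅ complete m
≅-complete {n} D refl adjacent = ⤖-id (Fin n) , arc-complete
  where
  arc-complete : ∀ u v → arc (complete n) u v ≡ arc D u v
  arc-complete u v with u ≟ v
  ... | yes refl = sym (no-loop D u)
  ... | no u≢v = sym (∈-tabulate⁻ (adjacent (u≢v ∘ sym)))

lemma3p3 : (t λ' n : ℕ) → t ≥ 2 → λ' ≥ 1 → (D : Digraph n) → IsLiking t λ' D →
    (∀ v → outdeg D v ≡ t + λ' ∸ 1) → D ≅ complete (t + λ')
lemma3p3 (suc (suc s)) (suc l) n _ _ D (t≤n , liking) regular =
  ≅-complete D (order (fromℕ< t≤n)) ≢⇒∈outSet
  where open Liking D s l liking regular
lemma3p3 (suc zero) _ _ (s≤s ()) _ _ _ _
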